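{- Let $\Sigma$ be a finite alphabet, $\vartheta$ a commutation relation on $\Sigma$, $B\subseteq\Sigma$, $Z=\Sigma\setminus B$, and let $L\subseteq\mathbf{M}(\Sigma,\vartheta)$ be the submonoid of traces whose terminal alphabet is contained in $Z$. Let $G(L)=L\setminus L^2$, where $L^2=\{uv: u,v\in L\setminus\{1\}\}$, be the minimal generating set of $L$. Let $\mathcal{A}_\beta$ be the automaton over $\Sigma$ whose states are all subsets of $B$ together with two additional states $F$ and $H$, with unique initial state $\emptyset$, unique final state $F$, and the following transitions: (a) for $B'\subseteq B$ and $b\in B$, $(B',b,(B'\cup\{b\})\cap\mathrm{Com}(b)\cap B)$; (b) for $B'\subseteq B$ and $z\in Z$, $(B',z,F)$ if $B'\cap\mathrm{Com}(z)=\emptyset$ (equivalently $(B'\cup\{z\})\cap\mathrm{Com}(z)\cap B=\emptyset$), and $(B',z,H)$ otherwise; (c) $(F,x,H)$ and $(H,x,H)$ for every $x\in\Sigma$. Then $\mathcal{A}_\beta$ recognizes $\mathrm{Rep}(G(L))$; in particular $G(L)$ is recognizable.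
   Context: A commutation relation $\vartheta$ on $\Sigma$ is a reflexive and symmetric relation. The trace monoid $\mathbf{M}(\Sigma,\vartheta)=\Sigma^*/\equiv_\vartheta$, where $\equiv_\vartheta$ is the congruence generated by $ab\equiv ba$ for $(a,b)\in\vartheta$; $1$ denotes the empty trace. Let $\phi:\Sigma^*\to\mathbf{M}(\Sigma,\vartheta)$ be the natural surjection; for a set $S$ of traces, $\mathrm{Rep}(S)=\phi^{ -1}(S)$, and $S$ is recognizable if $\mathrm{Rep}(S)$ is a regular language. For $x\in\Sigma$, $\mathrm{Com}(x)=\{z\in\Sigma:(x,z)\in\vartheta\}$. The terminal alphabet of a trace $w$ is $TA(w)=\{x\in\Sigma : w=ux \text{ for some trace } u\}$. -}

module Defs where

open import Data.Nat using (ℕ)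
open import Data.Fin using (Fin)
open import Data.Bool using (Bool; true; false)
open import Data.Bool.Properties using () renaming (_≟_ to _≟ᵇ_)
open import Data.List using (List; []; _∷_; _++_; _∷ʳ_; foldl)
open import Data.Vec using (tabulate)
open import Data.Vec.Properties using (≡-dec)
open import Data.Fin.Subset using (Subset; _∈_; _∉_; _∪_; _∩_; ⁅_⁆; ⊥)
open import Data.Fin.Subset.Properties using (_∈?_)
open import Data.Product using (Σ; ∃; _×_)
open import Relation.Nullary using (¬_; yes; no)
open import Relation.Binary.PropositionalEquality using (_≡_; _≢_)

CommRel : ℕ → Set
CommRel n = Fin n → Fin n → Bool

IsCommutation : {n : ℕ} → CommRel n → Set
IsCommutation {n} θ = (∀ (a : Fin n) → θ a a ≡ true) × (∀ (a b : Fin n) → θ a b ≡ θ b a)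

module Traces {n : ℕ} (θ : CommRel n) where

  Word : Set
  Word = List (Fin n)

  -- ≡_ϑ : the congruence on Σ* generated by ab ≡ ba for (a,b) ∈ ϑ.
  -- Two words are equal in M(Σ,ϑ) iff they are related by _≈_, i.e.
  -- φ u = φ v  ⇔  u ≈ v.
  infix 4 _≈_
  data _≈_ : Word → Word → Set where
    swap  : ∀ (u v : Word) (a b : Fin n) → θ a b ≡ true →
            (u ++ a ∷ b ∷ v) ≈ (u ++ b ∷ a ∷ v)
    ≈-refl  : ∀ {u} → u ≈ u
    ≈-sym   : ∀ {u v} → u ≈ v → v ≈ u
    ≈-trans : ∀ {u v w} → u ≈ v → v ≈ w → u ≈ w

  Com : Fin n → Subset n
  Com x = tabulate (θ x)

  InTA : Fin n → Word → Set
  InTA x w = Σ Word λ u → w ≈ u ∷ʳ x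

  module WithB (B : Subset n) where

    InL : Word → Set
    InL w = ∀ (x : Fin n) → InTA x w → x ∉ B

    IsOne : Word → Set
    IsOne w = w ≈ []

    InL² : Word → Set
    InL² w = Σ Word λ u → Σ Word λ v →
               InL u × ¬ IsOne u × InL v × ¬ IsOne v × w ≈ u ++ v

    InG : Word → Set
    InG w = InL w × ¬ IsOne w × ¬ InL² w

    data State : Set where
      sub : Subset n → State   -- B' ⊆ B  (only such subsets are reachable)
      F   : State
      H   : State

    δ : State → Fin n → State
    δ (sub B') x with x ∈? B
    ... | yes _ = sub ((B' ∪ ⁅ x ⁆) ∩ (Com x ∩ B))
    ... | no  _ with ≡-dec _≟ᵇ_ (B' ∩ Com x) ⊥
    ...   | yes _ = F
    ...   | no  _ = H
    δ F _ = H
    δ H _ = H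

    run : State → Word → State
    run = foldl δ

    Accepts : Word → Set
    Accepts w = run (sub ⊥) w ≡ F

-- Reading u ∈ B* from ∅, A_β tracks the set of letters of B that are terminal in u, so it
-- accepts exactly the words u z with u ∈ B*, z ∈ Z and no B-terminal letter of u commuting
-- with z: these are the elements of L containing exactly one letter of Z.  Every element of
-- L ∖ {1} ends with a letter of Z and the number of Z-letters is a trace invariant, so such
-- words are not in L².  Conversely, an element p c s z of L with an earlier letter c ∈ Z
-- factors in L² as (q c)(V s z), where q is the part of p on which c depends.
module Submission where

open import Defs
open import Data.Bool using (true; false)
open import Data.Bool.Properties using (¬-not) renaming (_≟_ to _≟ᵇ_)
open import Data.Empty using (⊥-elim)
open import Data.Fin using (Fin; _≟_)
open import Data.Vec using (tabulate)
open import Data.Vec.Properties using (≡-dec; lookup∘tabulate; lookup⇒[]=; []=⇒lookup)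
open import Data.Fin.Subset using (Subset; _∈_; _∉_; _∪_; _∩_; ⁅_⁆; ⊥)
open import Data.Fin.Subset.Properties
  using (_∈?_; Empty-unique; ∉⊥; x∈p∩q⁺; x∈p∩q⁻; x∈p∪q⁺; x∈p∪q⁻; x∈⁅x⁆; x∈⁅y⁆⇒x≡y)
open import Data.List using (List; []; _∷_; _++_; _∷ʳ_; [_]; filter; length; initLast; _∷ʳ′_)
open import Data.List.Properties
  using (++-assoc; ++-identityʳ; ++-conicalʳ; length-++;
         filter-++; filter-accept; filter-reject; filter-none; foldl-∷ʳ; ∷ʳ-injectiveʳ)
open import Data.List.Membership.Propositional using (find) renaming (_∈_ to _∈ₗ_)
open import Data.List.Membership.Propositional.Properties using (∈-∃++; ∈-++⁻)
open import Data.List.Relation.Unary.All as All using (All; []; _∷_; all?)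
open import Data.List.Relation.Unary.All.Properties using (¬Any⇒All¬; ¬All⇒Any¬; ++⁺)
open import Data.List.Relation.Unary.Any using (Any; here; any?)
open import Data.List.Reverse using (Reverse; []; _∶_∶ʳ_; reverseView)
open import Data.Nat using (ℕ; _+_; _≤_)
open import Data.Nat.Properties using (+-mono-≤; m≤n+m; m+1+n≢0; <-irrefl)
open import Data.Product using (∃-syntax; _×_; _,_; proj₁; proj₂)
open import Data.Sum using (_⊎_; inj₁; inj₂)
open import Function using (case_of_)
open import Level using (0ℓ)
open import Relation.Nullary using (¬_; yes; no)
open import Relation.Nullary.Decidable using (_⊎-dec_; ¬?)
open import Relation.Unary using (Pred; Decidable)
open import Relation.Binary.Bundles using (Setoid)
import Relation.Binary.Reasoning.Setoid as SetoidReasoning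
open import Relation.Binary.PropositionalEquality using (_≡_; _≢_; refl; sym; trans; cong; subst; subst₂; module ≡-Reasoning)

module _ {n : ℕ} where

  length-filter-++ : ∀ {P : Pred (Fin n) 0ℓ} (P? : Decidable P) u v →
                     length (filter P? (u ++ v)) ≡ length (filter P? u) + length (filter P? v)
  length-filter-++ P? u v = trans (cong length (filter-++ P? u v)) (length-++ (filter P? u))

  InPair : Fin n → Fin n → Fin n → Set
  InPair x y c = c ≡ x ⊎ c ≡ y

  ∉pair : ∀ {x y c} → c ≢ x → c ≢ y → ¬ InPair x y c
  ∉pair c≢x _ (inj₁ c≡x) = c≢x c≡x
  ∉pair _ c≢y (inj₂ c≡y) = c≢y c≡y

  inPair? : ∀ x y → Decidable (InPair x y)
  inPair? x y c = c ≟ x ⊎-dec c ≟ y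

  π : Fin n → Fin n → List (Fin n) → List (Fin n)
  π x y = filter (inPair? x y)

  EndsIn : Fin n → List (Fin n) → Set
  EndsIn y w = ∃[ r ] w ≡ r ∷ʳ y

  π-∷ʳ-∈ : ∀ {x y c} u → InPair x y c → π x y (u ∷ʳ c) ≡ π x y u ∷ʳ c
  π-∷ʳ-∈ {x} {y} {c} u c∈xy =
    trans (filter-++ _ u [ c ]) (cong (π x y u ++_) (filter-accept (inPair? x y) c∈xy))

  π-∷ʳ-∉ : ∀ {x y c} u → ¬ InPair x y c → π x y (u ∷ʳ c) ≡ π x y u
  π-∷ʳ-∉ {x} {y} {c} u c∉xy =
    trans (filter-++ _ u [ c ])
      (trans (cong (π x y u ++_) (filter-reject (inPair? x y) c∉xy)) (++-identityʳ _))

  EndsIn-π-∷ : ∀ {x y} c u → EndsIn y (π x y u) → EndsIn y (π x y (c ∷ u))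
  EndsIn-π-∷ {x} {y} c u (r , e) with inPair? x y c
  ... | yes c∈xy = c ∷ r , trans (filter-accept (inPair? x y) c∈xy) (cong (c ∷_) e)
  ... | no c∉xy  = r , trans (filter-reject (inPair? x y) c∉xy) e

  ∷ʳ≢[] : ∀ (r : List (Fin n)) {a} → r ∷ʳ a ≢ []
  ∷ʳ≢[] r e with () ← ++-conicalʳ r _ e

  π-absent-EndsIn : ∀ {x y u} → Reverse u → π x x u ≡ [] → y ∈ₗ u → EndsIn y (π x y u)
  π-absent-EndsIn {x} {y} (u ∶ rev ∶ʳ c) absent y∈uc with c ≟ y | c ≟ x
  ... | yes refl | _        = π x y u , π-∷ʳ-∈ u (inj₂ refl)
  ... | no _     | yes refl = ⊥-elim (∷ʳ≢[] (π x x u) (trans (sym (π-∷ʳ-∈ u (inj₁ refl))) absent))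
  ... | no c≢y   | no c≢x with ∈-++⁻ u y∈uc
  ...   | inj₂ (here y≡c) = ⊥-elim (c≢y (sym y≡c))
  ...   | inj₁ y∈u with r , ends-y ← π-absent-EndsIn rev (trans (sym (π-∷ʳ-∉ u (∉pair c≢x c≢x))) absent) y∈u
    = r , trans (π-∷ʳ-∉ u (∉pair c≢x c≢y)) ends-y


module _ {n : ℕ} (θ : CommRel n) where
  open Traces θ

  θ⇒∈Com : ∀ {a x} → θ a x ≡ true → x ∈ Com a
  θ⇒∈Com {a} {x} ax = lookup⇒[]= x (tabulate (θ a)) (trans (lookup∘tabulate (θ a) x) ax)

  ∈Com⇒θ : ∀ {a x} → x ∈ Com a → θ a x ≡ true
  ∈Com⇒θ {a} {x} x∈Com = trans (sym (lookup∘tabulate (θ a) x)) ([]=⇒lookup x∈Com)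

module _ {n : ℕ} {θ : CommRel n} where
  open Traces θ

  ≈-setoid : Setoid 0ℓ 0ℓ
  ≈-setoid = record
    { Carrier = Word ; _≈_ = _≈_ ; isEquivalence = record { refl = ≈-refl ; sym = ≈-sym ; trans = ≈-trans } }

  module ≈-Reasoning = SetoidReasoning ≈-setoid

  ≡⇒≈ : ∀ {u v} → u ≡ v → u ≈ v
  ≡⇒≈ refl = ≈-refl

  ≈-++ˡ : ∀ p {u v} → u ≈ v → p ++ u ≈ p ++ v
  ≈-++ˡ p (swap u v a b ab) =
    subst₂ _≈_ (++-assoc p u (a ∷ b ∷ v)) (++-assoc p u (b ∷ a ∷ v)) (swap (p ++ u) v a b ab)
  ≈-++ˡ p ≈-refl          = ≈-refl
  ≈-++ˡ p (≈-sym h)       = ≈-sym (≈-++ˡ p h)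
  ≈-++ˡ p (≈-trans h h′)  = ≈-trans (≈-++ˡ p h) (≈-++ˡ p h′)

  ≈-++ʳ : ∀ s {u v} → u ≈ v → u ++ s ≈ v ++ s
  ≈-++ʳ s (swap u v a b ab) =
    subst₂ _≈_ (sym (++-assoc u (a ∷ b ∷ v) s)) (sym (++-assoc u (b ∷ a ∷ v) s)) (swap u (v ++ s) a b ab)
  ≈-++ʳ s ≈-refl          = ≈-refl
  ≈-++ʳ s (≈-sym h)       = ≈-sym (≈-++ʳ s h)
  ≈-++ʳ s (≈-trans h h′)  = ≈-trans (≈-++ʳ s h) (≈-++ʳ s h′)

  ≈-invariant : ∀ {A : Set} (f : Word → A) →
                (∀ p {u v} → f u ≡ f v → f (p ++ u) ≡ f (p ++ v)) →
                (∀ a b v → θ a b ≡ true → f (a ∷ b ∷ v) ≡ f (b ∷ a ∷ v)) →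
                ∀ {u v} → u ≈ v → f u ≡ f v
  ≈-invariant f f-++ f-swap (swap u v a b ab) = f-++ u (f-swap a b v ab)
  ≈-invariant f f-++ f-swap ≈-refl            = refl
  ≈-invariant f f-++ f-swap (≈-sym h)         = sym (≈-invariant f f-++ f-swap h)
  ≈-invariant f f-++ f-swap (≈-trans h h′)    =
    trans (≈-invariant f f-++ f-swap h) (≈-invariant f f-++ f-swap h′)

  module _ {P : Pred (Fin n) 0ℓ} (P? : Decidable P) where

    private
      filter-∷∷ : ∀ a b v → filter P? (a ∷ b ∷ v) ≡ filter P? [ a ] ++ filter P? [ b ] ++ filter P? v
      filter-∷∷ a b v = trans (filter-++ P? [ a ] (b ∷ v)) (cong (filter P? [ a ] ++_) (filter-++ P? [ b ] v))

      filter-++-cong : ∀ p {u v} → filter P? u ≡ filter P? v → filter P? (p ++ u) ≡ filter P? (p ++ v)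
      filter-++-cong p {u} {v} e =
        trans (filter-++ P? p u) (trans (cong (filter P? p ++_) e) (sym (filter-++ P? p v)))

    length-filter-≈ : ∀ {u v} → u ≈ v → length (filter P? u) ≡ length (filter P? v)
    length-filter-≈ = ≈-invariant (λ w → length (filter P? w)) length-filter-++-cong length-filter-swap
      where
      length-filter-++-cong : ∀ p {u v} → length (filter P? u) ≡ length (filter P? v) →
                              length (filter P? (p ++ u)) ≡ length (filter P? (p ++ v))
      length-filter-++-cong p {u} {v} e =
        trans (length-filter-++ P? p u) (trans (cong (length (filter P? p) +_) e) (sym (length-filter-++ P? p v)))

      length-singletons-comm : ∀ a b w → length (filter P? [ a ] ++ filter P? [ b ] ++ w)
                                       ≡ length (filter P? [ b ] ++ filter P? [ a ] ++ w)
      length-singletons-comm a b w with P? a | P? b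
      ... | yes _ | yes _ = refl
      ... | yes _ | no _  = refl
      ... | no _  | yes _ = refl
      ... | no _  | no _  = refl

      length-filter-swap : ∀ a b v → θ a b ≡ true →
                           length (filter P? (a ∷ b ∷ v)) ≡ length (filter P? (b ∷ a ∷ v))
      length-filter-swap a b v _ =
        trans (cong length (filter-∷∷ a b v))
          (trans (length-singletons-comm a b (filter P? v)) (cong length (sym (filter-∷∷ b a v))))

    filter-≈ : (∀ {a b} → θ a b ≡ true → P a → P b → a ≡ b) →
               ∀ {u v} → u ≈ v → filter P? u ≡ filter P? v
    filter-≈ noCommutingPair = ≈-invariant (filter P?) filter-++-cong filter-swap
      where
      singletons-comm : ∀ a b w → θ a b ≡ true →
                        filter P? [ a ] ++ filter P? [ b ] ++ w ≡ filter P? [ b ] ++ filter P? [ a ] ++ w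
      singletons-comm a b w ab with P? a | P? b
      ... | yes pa | yes pb with refl ← noCommutingPair ab pa pb = refl
      ... | yes _  | no _  = refl
      ... | no _   | yes _ = refl
      ... | no _   | no _  = refl

      filter-swap : ∀ a b v → θ a b ≡ true → filter P? (a ∷ b ∷ v) ≡ filter P? (b ∷ a ∷ v)
      filter-swap a b v ab =
        trans (filter-∷∷ a b v) (trans (singletons-comm a b (filter P? v) ab) (sym (filter-∷∷ b a v)))

  commute-past : ∀ {x q} → All (λ c → θ x c ≡ true) q → x ∷ q ≈ q ∷ʳ x
  commute-past []                         = ≈-refl
  commute-past {x} {c ∷ q} (xc ∷ commutes) = ≈-trans (swap [] q x c xc) (≈-++ˡ [ c ] (commute-past commutes))

  InTA-≈ : ∀ {x u v} → u ≈ v → InTA x v → InTA x u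
  InTA-≈ u≈v (r , v≈rx) = r , ≈-trans u≈v v≈rx

  InTA-++ : ∀ {x} p {v} → InTA x v → InTA x (p ++ v)
  InTA-++ {x} p (r , v≈rx) = p ++ r , ≈-trans (≈-++ˡ p v≈rx) (≡⇒≈ (sym (++-assoc p r [ x ])))

module _ {n : ℕ} {θ : CommRel n} (isCommutation : IsCommutation θ) where
  open Traces θ

  private
    θ-refl : ∀ a → θ a a ≡ true
    θ-refl = proj₁ isCommutation

    θ-sym : ∀ a b → θ a b ≡ θ b a
    θ-sym = proj₂ isCommutation

    false≢true : false ≢ true
    false≢true ()

  pair-commuting⇒≡ : ∀ {x y a b} → x ≡ y ⊎ θ x y ≡ false → θ a b ≡ true →
                     InPair x y a → InPair x y b → a ≡ b
  pair-commuting⇒≡ _          _  (inj₁ refl) (inj₁ refl) = refl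
  pair-commuting⇒≡ _          _  (inj₂ refl) (inj₂ refl) = refl
  pair-commuting⇒≡ (inj₁ x≡y) _  (inj₁ refl) (inj₂ refl) = x≡y
  pair-commuting⇒≡ (inj₁ x≡y) _  (inj₂ refl) (inj₁ refl) = sym x≡y
  pair-commuting⇒≡ (inj₂ xy)  ab (inj₁ refl) (inj₂ refl) = ⊥-elim (false≢true (trans (sym xy) ab))
  pair-commuting⇒≡ {x} {y} (inj₂ xy) ab (inj₂ refl) (inj₁ refl) =
    ⊥-elim (false≢true (trans (sym xy) (trans (θ-sym x y) ab)))

  π-≈ : ∀ {x y u v} → x ≡ y ⊎ θ x y ≡ false → u ≈ v → π x y u ≡ π x y v
  π-≈ {x} {y} x≡y∨xy = filter-≈ (inPair? x y) (pair-commuting⇒≡ x≡y∨xy)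

  -- Read through the projection onto {x, y}: either x does not occur in w, or the last
  -- occurrence of x is followed by some y that does not commute with it.
  NonTerminal : Fin n → Word → Set
  NonTerminal x w = π x x w ≡ [] ⊎ ∃[ y ] θ x y ≡ false × EndsIn y (π x y w)

  Terminal : Fin n → Word → Set
  Terminal x w = ∃[ p ] ∃[ q ] w ≡ p ++ x ∷ q × All (λ c → θ x c ≡ true) q

  terminal⇒InTA : ∀ {x w} → Terminal x w → InTA x w
  terminal⇒InTA {x} (p , q , refl , commutes) =
    p ++ q , ≈-trans (≈-++ˡ p (commute-past commutes)) (≡⇒≈ (sym (++-assoc p q [ x ])))

  nonTerminal⇒¬InTA : ∀ {x w} → NonTerminal x w → ¬ InTA x w
  nonTerminal⇒¬InTA {x} (inj₁ absent) (r , w≈rx) =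
    ∷ʳ≢[] (π x x r) (trans (sym (π-∷ʳ-∈ r (inj₁ refl))) (trans (sym (π-≈ (inj₁ refl) w≈rx)) absent))
  nonTerminal⇒¬InTA {x} (inj₂ (y , xy , r , ends-y)) (s , w≈sx) =
    false≢true (trans (sym xy) (trans (cong (θ x) y≡x) (θ-refl x)))
    where
    y≡x : y ≡ x
    y≡x = ∷ʳ-injectiveʳ r (π x y s)
            (trans (sym ends-y) (trans (π-≈ (inj₂ xy) w≈sx) (π-∷ʳ-∈ s (inj₁ refl))))

  terminal-∷ʳ : ∀ {x u a} → θ x a ≡ true → Terminal x u → Terminal x (u ∷ʳ a)
  terminal-∷ʳ {x} {a = a} xa (p , q , refl , commutes) =
    p , q ∷ʳ a , ++-assoc p (x ∷ q) [ a ] , ++⁺ commutes (xa ∷ [])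

  nonTerminal-∷ʳ-dependent : ∀ {x} u {a} → θ x a ≡ false → NonTerminal x (u ∷ʳ a)
  nonTerminal-∷ʳ-dependent {x} u {a} xa = inj₂ (a , xa , π x a u , π-∷ʳ-∈ u (inj₂ refl))

  nonTerminal-∷ʳ : ∀ {x} u {a} → a ≢ x → NonTerminal x u → NonTerminal x (u ∷ʳ a)
  nonTerminal-∷ʳ u a≢x (inj₁ absent) = inj₁ (trans (π-∷ʳ-∉ u (∉pair a≢x a≢x)) absent)
  nonTerminal-∷ʳ u {a} a≢x (inj₂ (y , xy , r , ends-y)) with a ≟ y
  ... | yes refl = nonTerminal-∷ʳ-dependent u xy
  ... | no a≢y   = inj₂ (y , xy , r , trans (π-∷ʳ-∉ u (∉pair a≢x a≢y)) ends-y)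

  nonTerminal-∷ : ∀ {x a u} → a ≢ x → NonTerminal x u → NonTerminal x (a ∷ u)
  nonTerminal-∷ {x} {a} a≢x (inj₁ absent) =
    inj₁ (trans (filter-reject (inPair? x x) (∉pair a≢x a≢x)) absent)
  nonTerminal-∷ {a = a} {u} _ (inj₂ (y , xy , ends-y)) = inj₂ (y , xy , EndsIn-π-∷ a u ends-y)

  nonTerminal-∷-self : ∀ {x u} → Any (λ y → θ x y ≡ false) u → NonTerminal x u → NonTerminal x (x ∷ u)
  nonTerminal-∷-self {x} {u} _ (inj₂ (y , xy , ends-y)) = inj₂ (y , xy , EndsIn-π-∷ x u ends-y)
  nonTerminal-∷-self {x} {u} dependent (inj₁ absent) with y , y∈u , xy ← find dependent =
    inj₂ (y , xy , EndsIn-π-∷ x u (π-absent-EndsIn (reverseView u) absent y∈u))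

  -- q collects the letters of p on which U depends, directly or through other such letters;
  -- every remaining letter commutes past q ++ U into V.
  factor-past : ∀ p U → ∃[ q ] ∃[ V ] p ++ U ≈ (q ++ U) ++ V ×
                          (∀ x → NonTerminal x U → NonTerminal x (q ++ U))
  factor-past []      U = [] , [] , ≡⇒≈ (sym (++-identityʳ U)) , λ _ nonTerminal → nonTerminal
  factor-past (a ∷ p) U with q , V , pU≈qUV , inherit ← factor-past p U
                           | any? (λ y → θ a y ≟ᵇ false) (q ++ U)
  ... | yes dependent = a ∷ q , V , ≈-++ˡ [ a ] pU≈qUV , inherit′
    where
    inherit′ : ∀ x → NonTerminal x U → NonTerminal x (a ∷ q ++ U)
    inherit′ x nonTerminal = case a ≟ x of λ where
      (yes refl) → nonTerminal-∷-self dependent (inherit x nonTerminal)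
      (no a≢x)   → nonTerminal-∷ a≢x (inherit x nonTerminal)
  ... | no independent = q , a ∷ V , ≈-trans (≈-++ˡ [ a ] pU≈qUV) a-commutes-past , inherit
    where
    a-commutes-past : a ∷ (q ++ U) ++ V ≈ (q ++ U) ++ a ∷ V
    a-commutes-past = ≈-trans (≈-++ʳ V (commute-past (All.map ¬-not (¬Any⇒All¬ _ independent))))
                              (≡⇒≈ (++-assoc (q ++ U) [ a ] V))

  module _ (B : Subset n) where
    open WithB B

    Z? : Decidable (_∉ B)
    Z? c = ¬? (c ∈? B)

    #Z : Word → ℕ
    #Z w = length (filter Z? w)

    #Z-++ : ∀ u v → #Z (u ++ v) ≡ #Z u + #Z v
    #Z-++ = length-filter-++ Z?

    #Z-∷ʳ : ∀ u {z} → z ∉ B → #Z (u ∷ʳ z) ≡ #Z u + 1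
    #Z-∷ʳ u {z} z∉B = trans (#Z-++ u [ z ]) (cong (λ l → #Z u + length l) (filter-accept Z? {xs = []} z∉B))

    #Z-B* : ∀ {u} → All (_∈ B) u → #Z u ≡ 0
    #Z-B* u∈B* = cong length (filter-none Z? (All.map (λ c∈B c∉B → c∉B c∈B) u∈B*))

    ¬IsOne-∷ʳ : ∀ u {z} → z ∉ B → ¬ IsOne (u ∷ʳ z)
    ¬IsOne-∷ʳ u {z} z∉B uz≈[] = m+1+n≢0 (#Z u) (trans (sym (#Z-∷ʳ u z∉B)) (length-filter-≈ Z? uz≈[]))

    InL⇒1≤#Z : ∀ {u} → InL u → ¬ IsOne u → 1 ≤ #Z u
    InL⇒1≤#Z {u} u∈L u≢1 with initLast u
    ... | []      = ⊥-elim (u≢1 ≈-refl)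
    ... | r ∷ʳ′ z = subst (1 ≤_) (sym (#Z-∷ʳ r (u∈L z (r , ≈-refl)))) (m≤n+m 1 (#Z r))

    InL²⇒2≤#Z : ∀ {w} → InL² w → 2 ≤ #Z w
    InL²⇒2≤#Z (u , v , u∈L , u≢1 , v∈L , v≢1 , w≈uv) =
      subst (2 ≤_) (sym (trans (length-filter-≈ Z? w≈uv) (#Z-++ u v))) (+-mono-≤ (InL⇒1≤#Z u∈L u≢1) (InL⇒1≤#Z v∈L v≢1))

    extend : Subset n → Fin n → Subset n
    extend S a = (S ∪ ⁅ a ⁆) ∩ (Com a ∩ B)

    δ-∈B : ∀ {S a} → a ∈ B → δ (sub S) a ≡ sub (extend S a)
    δ-∈B {a = a} a∈B with a ∈? B
    ... | yes _   = refl
    ... | no a∉B  = ⊥-elim (a∉B a∈B)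

    δ≡sub⁻¹ : ∀ {s a T} → δ s a ≡ sub T → ∃[ S ] s ≡ sub S × a ∈ B × T ≡ extend S a
    δ≡sub⁻¹ {sub S} {a} e with a ∈? B
    δ≡sub⁻¹ {sub S} {a} refl | yes a∈B = S , refl , a∈B , refl
    ... | no _ with ≡-dec _≟ᵇ_ (S ∩ Com a) ⊥
    δ≡sub⁻¹ {sub S} {a} () | no _ | yes _
    δ≡sub⁻¹ {sub S} {a} () | no _ | no _

    δ≡F⁻¹ : ∀ {s z} → δ s z ≡ F → ∃[ S ] s ≡ sub S × z ∉ B × S ∩ Com z ≡ ⊥
    δ≡F⁻¹ {sub S} {z} e with z ∈? B
    δ≡F⁻¹ {sub S} {z} () | yes _
    ... | no z∉B with ≡-dec _≟ᵇ_ (S ∩ Com z) ⊥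
    ...   | yes S∩Com≡⊥ = S , refl , z∉B , S∩Com≡⊥
    δ≡F⁻¹ {sub S} {z} () | no _ | no _

    δ-F : ∀ {S z} → z ∉ B → S ∩ Com z ≡ ⊥ → δ (sub S) z ≡ F
    δ-F {S} {z} z∉B S∩Com≡⊥ with z ∈? B
    ... | yes z∈B = ⊥-elim (z∉B z∈B)
    ... | no _ with ≡-dec _≟ᵇ_ (S ∩ Com z) ⊥
    ...   | yes _       = refl
    ...   | no S∩Com≢⊥  = ⊥-elim (S∩Com≢⊥ S∩Com≡⊥)

    run-∷ʳ : ∀ s u a → run s (u ∷ʳ a) ≡ δ (run s u) a
    run-∷ʳ s u a = foldl-∷ʳ δ s a u

    record RunInvariant (u : Word) (S : Subset n) : Set where
      field
        nonTerminal : ∀ {x} → x ∈ B → x ∉ S → NonTerminal x u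
        terminal    : ∀ {x} → x ∈ S → x ∈ B × Terminal x u
    open RunInvariant

    runInvariant-[] : RunInvariant [] ⊥
    runInvariant-[] = record { nonTerminal = λ _ _ → inj₁ refl ; terminal = λ x∈⊥ → ⊥-elim (∉⊥ x∈⊥) }

    ∈-extend⁺ : ∀ {S a x} → x ∈ S ⊎ x ≡ a → θ a x ≡ true → x ∈ B → x ∈ extend S a
    ∈-extend⁺ (inj₁ x∈S)  ax x∈B = x∈p∩q⁺ (x∈p∪q⁺ (inj₁ x∈S) , x∈p∩q⁺ (θ⇒∈Com θ ax , x∈B))
    ∈-extend⁺ (inj₂ refl) ax x∈B = x∈p∩q⁺ (x∈p∪q⁺ (inj₂ (x∈⁅x⁆ _)) , x∈p∩q⁺ (θ⇒∈Com θ ax , x∈B))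

    runInvariant-∷ʳ : ∀ {u S a} → a ∈ B → RunInvariant u S → RunInvariant (u ∷ʳ a) (extend S a)
    runInvariant-∷ʳ {u} {S} {a} a∈B inv = record { nonTerminal = nonTerminal′ ; terminal = terminal′ }
      where
      nonTerminal′ : ∀ {x} → x ∈ B → x ∉ extend S a → NonTerminal x (u ∷ʳ a)
      nonTerminal′ {x} x∈B x∉S′ with x ≟ a | θ a x in ax
      ... | yes refl | _     = ⊥-elim (x∉S′ (∈-extend⁺ (inj₂ refl) (θ-refl x) x∈B))
      ... | no x≢a   | false = nonTerminal-∷ʳ-dependent u (trans (θ-sym x a) ax)
      ... | no x≢a   | true  =
        nonTerminal-∷ʳ u (λ a≡x → x≢a (sym a≡x)) (nonTerminal inv x∈B (λ x∈S → x∉S′ (∈-extend⁺ (inj₁ x∈S) ax x∈B)))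

      terminal′ : ∀ {x} → x ∈ extend S a → x ∈ B × Terminal x (u ∷ʳ a)
      terminal′ {x} x∈S′ with x∈S∪a , x∈Com∩B ← x∈p∩q⁻ _ _ x∈S′
                         with x∈Com , x∈B ← x∈p∩q⁻ _ _ x∈Com∩B
                         with x∈p∪q⁻ S ⁅ a ⁆ x∈S∪a
      ... | inj₁ x∈S = x∈B , terminal-∷ʳ (trans (θ-sym x a) (∈Com⇒θ θ x∈Com)) (proj₂ (terminal inv x∈S))
      ... | inj₂ x∈a with refl ← x∈⁅y⁆⇒x≡y a x∈a = x∈B , u , [] , refl , []

    run-invariant : ∀ {u S} → Reverse u → run (sub ⊥) u ≡ sub S → All (_∈ B) u × RunInvariant u S
    run-invariant [] refl = [] , runInvariant-[]
    run-invariant (u ∶ rev ∶ʳ a) run≡S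
      with S′ , run≡S′ , a∈B , refl ← δ≡sub⁻¹ {a = a} (trans (sym (run-∷ʳ (sub ⊥) u a)) run≡S)
      with u∈B* , inv ← run-invariant rev run≡S′
      = ++⁺ u∈B* (a∈B ∷ []) , runInvariant-∷ʳ a∈B inv

    run-B* : ∀ {S₀ u} → All (_∈ B) u → ∃[ S ] run (sub S₀) u ≡ sub S
    run-B* {S₀} []                = S₀ , refl
    run-B* {S₀} (a∈B ∷ u∈B*) rewrite δ-∈B {S₀} a∈B = run-B* u∈B*

    InL-∷ʳ⁺ : ∀ {u S z} → RunInvariant u S → z ∉ B → S ∩ Com z ≡ ⊥ → InL (u ∷ʳ z)
    InL-∷ʳ⁺ {u} {S} {z} inv z∉B S∩Com≡⊥ x x∈TA x∈B = nonTerminal⇒¬InTA nonTerminal-x x∈TA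
      where
      nonTerminal-x : NonTerminal x (u ∷ʳ z)
      nonTerminal-x with θ z x in zx
      ... | false = nonTerminal-∷ʳ-dependent u (trans (θ-sym x z) zx)
      ... | true  = nonTerminal-∷ʳ u (λ z≡x → z∉B (subst (_∈ B) (sym z≡x) x∈B))
                      (nonTerminal inv x∈B (λ x∈S → ∉⊥ (subst (x ∈_) S∩Com≡⊥ (x∈p∩q⁺ (x∈S , θ⇒∈Com θ zx)))))

    InL-∷ʳ⁻ : ∀ {u S z} → RunInvariant u S → InL (u ∷ʳ z) → S ∩ Com z ≡ ⊥
    InL-∷ʳ⁻ {u} {S} {z} inv uz∈L = Empty-unique λ (x , x∈S∩Com) →
      let x∈S , x∈Com = x∈p∩q⁻ S (Com z) x∈S∩Com
          x∈B , terminal-x = terminal inv x∈S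
      in uz∈L x (terminal⇒InTA (terminal-∷ʳ (trans (θ-sym x z) (∈Com⇒θ θ x∈Com)) terminal-x)) x∈B

    InL-splits-at-Z : ∀ p {c} s z → c ∉ B → InL ((p ++ c ∷ s) ∷ʳ z) → InL² ((p ++ c ∷ s) ∷ʳ z)
    InL-splits-at-Z p {c} s z c∉B w∈L with q , V , pc≈qcV , inherit ← factor-past p [ c ] =
      q ∷ʳ c , (V ++ s) ∷ʳ z , qc∈L , ¬IsOne-∷ʳ q c∉B , Vsz∈L , ¬IsOne-∷ʳ (V ++ s) z∉B , w≈qc·Vsz
      where
      z∉B : z ∉ B
      z∉B = w∈L z (p ++ c ∷ s , ≈-refl)

      w≈qc·Vsz : (p ++ c ∷ s) ∷ʳ z ≈ (q ∷ʳ c) ++ (V ++ s) ∷ʳ z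
      w≈qc·Vsz = begin
        (p ++ c ∷ s) ∷ʳ z           ≡⟨ trans (++-assoc p (c ∷ s) [ z ]) (sym (++-assoc p [ c ] (s ∷ʳ z))) ⟩
        (p ++ [ c ]) ++ s ∷ʳ z      ≈⟨ ≈-++ʳ (s ∷ʳ z) pc≈qcV ⟩
        ((q ∷ʳ c) ++ V) ++ s ∷ʳ z   ≡⟨ trans (++-assoc (q ∷ʳ c) V (s ∷ʳ z)) (cong ((q ∷ʳ c) ++_) (sym (++-assoc V s [ z ]))) ⟩
        (q ∷ʳ c) ++ (V ++ s) ∷ʳ z   ∎
        where open ≈-Reasoning

      qc∈L : InL (q ∷ʳ c)
      qc∈L x x∈TA x∈B = nonTerminal⇒¬InTA (inherit x (nonTerminal-∷ c≢x (inj₁ refl))) x∈TA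
        where
        c≢x : c ≢ x
        c≢x c≡x = c∉B (subst (_∈ B) (sym c≡x) x∈B)

      Vsz∈L : InL ((V ++ s) ∷ʳ z)
      Vsz∈L x x∈TA = w∈L x (InTA-≈ w≈qc·Vsz (InTA-++ (q ∷ʳ c) x∈TA))

    accepted⇒InG : ∀ w → Accepts w → InG w
    accepted⇒InG w accepted with initLast w
    accepted⇒InG .[] () | []
    ... | u ∷ʳ′ z with S , run≡S , z∉B , S∩Com≡⊥ ← δ≡F⁻¹ (trans (sym (run-∷ʳ (sub ⊥) u z)) accepted)
                  with u∈B* , inv ← run-invariant (reverseView u) run≡S =
      InL-∷ʳ⁺ inv z∉B S∩Com≡⊥ , ¬IsOne-∷ʳ u z∉B , λ uz∈L² →
        <-irrefl refl (subst (2 ≤_) (trans (#Z-∷ʳ u z∉B) (cong (_+ 1) (#Z-B* u∈B*))) (InL²⇒2≤#Z uz∈L²))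

    InG⇒accepted : ∀ w → InG w → Accepts w
    InG⇒accepted w (w∈L , w≢1 , w∉L²) with initLast w
    ... | []      = ⊥-elim (w≢1 ≈-refl)
    ... | u ∷ʳ′ z with all? (_∈? B) u
    ...   | yes u∈B* with S , run≡S ← run-B* u∈B* = begin
      run (sub ⊥) (u ∷ʳ z)  ≡⟨ run-∷ʳ (sub ⊥) u z ⟩
      δ (run (sub ⊥) u) z   ≡⟨ cong (λ s → δ s z) run≡S ⟩
      δ (sub S) z           ≡⟨ δ-F (w∈L z (u , ≈-refl)) (InL-∷ʳ⁻ (proj₂ (run-invariant (reverseView u) run≡S)) w∈L) ⟩
      F                     ∎
      where open ≡-Reasoning
    ...   | no u∉B* with c , c∈u , c∉B ← find (¬All⇒Any¬ (_∈? B) u u∉B*)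
                    with p , s , refl ← ∈-∃++ c∈u =
      ⊥-elim (w∉L² (InL-splits-at-Z p s z c∉B w∈L))

proposition3 : ∀ (n : ℕ) (θ : CommRel n) → IsCommutation θ → (B : Subset n) →
    ∀ (w : List (Fin n)) →
      (Traces.WithB.Accepts θ B w → Traces.WithB.InG θ B w)
      × (Traces.WithB.InG θ B w → Traces.WithB.Accepts θ B w)
proposition3 n θ isCommutation B w = accepted⇒InG isCommutation B w , InG⇒accepted isCommutation B w
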